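{- Let $R$ be a transcendental Dedekind domain, and let $\lambda,\eta$ be non-zero elements algebraic over the fraction field of $R$ such that $\lambda/\eta$ is not a root of unity. Assume that $(\lambda+\eta)^2\in R$ and $\lambda\eta\in R$, and that the principal ideals $\langle(\lambda+\eta)^2\rangle$ and $\langle\lambda\eta\rangle$ of $R$ are coprime ideals which are not both equal to $R$. Define the Lehmer sequence $(U_n)_{n\ge1}$ by $U_n=\frac{\lambda^n-\eta^n}{\lambda-\eta}$ if $n$ is odd and $U_n=\frac{\lambda^n-\eta^n}{\lambda^2-\eta^2}$ if $n$ is even. Then $(U_n)_{n\ge1}$ is a strong divisibility sequence in $R$: for all positive integers $m,n$, a greatest common divisor $\gcd(U_m,U_n)$ in $R$ and $U_{\gcd(m,n)}$ are associated.
   Context: A Dedekind domain $R$ is called transcendental if it is not a field but contains a field. Two elements of $R$ are associated if one equals the other times a unit of $R$. A greatest common divisor of $a,b\in R$ is a common divisor of $a$ and $b$ that is divisible by every common divisor of $a$ and $b$. A sequence $(a_n)_{n\ge1}$ in $R$ is a strong divisibility sequence if for all positive integers $m,n$, $\gcd(a_m,a_n)$ and $a_d$ are associated, where $d=\gcd(m,n)$. -}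

module Defs where

open import Level using (0ℓ)
open import Algebra.Bundles using (CommutativeRing)
open import Data.Nat using (ℕ; zero; suc)
open import Data.Fin using (Fin)
open import Data.Nat.Divisibility using (_∣_)
open import Data.List using (List; []; _∷_; length)
open import Data.List.Relation.Unary.All using (All)
open import Data.List.Relation.Unary.Any using (Any)
open import Data.Product using (Σ; _×_; ∃)
open import Data.Sum using (_⊎_)
open import Relation.Nullary using (¬_)

-- Everything lives inside an ambient field L (given as a commutative ring
-- together with the field axioms).  A subring R ⊆ L is a predicate on the
-- carrier of L; elements algebraic over Frac(R) are elements of L.

module _ (L : CommutativeRing 0ℓ 0ℓ) where
  open CommutativeRing L

  record IsField : Set where
    field
      1≉0   : 1# ≉ 0#
      inv   : (x : Carrier) → x ≉ 0# → Carrier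
      inv-r : (x : Carrier) (p : x ≉ 0#) → x * inv x p ≈ 1#

  Pred : Set₁
  Pred = Carrier → Set

  _⊆_ : Pred → Pred → Set
  P ⊆ Q = ∀ {x} → P x → Q x

  pow : Carrier → ℕ → Carrier
  pow x zero    = 1#
  pow x (suc n) = x * pow x n

  sumF : (n : ℕ) → (Fin n → Carrier) → Carrier
  sumF zero    f = 0#
  sumF (suc n) f = f Fin.zero + sumF n (λ i → f (Fin.suc i))

  -- polynomial evaluation, coefficients listed from degree 0 upwards
  eval : List Carrier → Carrier → Carrier
  eval []       x = 0#
  eval (c ∷ cs) x = c + x * eval cs x

  record IsSubring (R : Pred) : Set where
    field
      resp  : ∀ {x y} → x ≈ y → R x → R y
      0∈    : R 0#
      1∈    : R 1#
      +-cl  : ∀ {x y} → R x → R y → R (x + y)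
      neg-cl : ∀ {x} → R x → R (- x)
      *-cl  : ∀ {x y} → R x → R y → R (x * y)

  record IsIdeal (R I : Pred) : Set where
    field
      resp  : ∀ {x y} → x ≈ y → I x → I y
      ⊆R    : I ⊆ R
      0∈    : I 0#
      +-cl  : ∀ {x y} → I x → I y → I (x + y)
      *-cl  : ∀ {r x} → R r → I x → I (r * x)

  Noetherian : Pred → Set₁
  Noetherian R = ∀ (I : Pred) → IsIdeal R I →
    Σ ℕ λ n → Σ (Fin n → Carrier) λ g → (∀ i → I (g i)) ×
      (∀ {x} → I x → Σ (Fin n → Carrier) λ r → (∀ i → R (r i)) ×
                      (x ≈ sumF n (λ i → r i * g i)))

  IsPrimeIdeal : Pred → Pred → Set
  IsPrimeIdeal R P = IsIdeal R P × ¬ P 1# ×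
    (∀ {a b} → R a → R b → P (a * b) → P a ⊎ P b)

  IsMaximalIdeal : Pred → Pred → Set₁
  IsMaximalIdeal R P = IsIdeal R P × ¬ P 1# ×
    (∀ (J : Pred) → IsIdeal R J → P ⊆ J → (J ⊆ P) ⊎ J 1#)

  DimLe1 : Pred → Set₁
  DimLe1 R = ∀ (P : Pred) → IsPrimeIdeal R P → (∃ λ x → P x × x ≉ 0#) →
    IsMaximalIdeal R P

  Frac : Pred → Pred
  Frac R x = Σ Carrier λ a → Σ Carrier λ b → R a × R b × b ≉ 0# × x * b ≈ a

  IntegrallyClosed : Pred → Set
  IntegrallyClosed R = ∀ {x} → Frac R x →
    (Σ (List Carrier) λ cs → All R cs × (pow x (length cs) + eval cs x ≈ 0#)) →
    R x

  -- Dedekind domain (R is a domain since it sits inside the field L):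
  -- Noetherian, integrally closed, dimension ≤ 1
  record IsDedekindDomain (R : Pred) : Set₁ where
    field
      subring    : IsSubring R
      noetherian : Noetherian R
      intClosed  : IntegrallyClosed R
      dim≤1      : DimLe1 R

  IsUnitIn : Pred → Carrier → Set
  IsUnitIn R x = R x × Σ Carrier λ y → R y × x * y ≈ 1#

  IsNotField : Pred → Set
  IsNotField R = Σ Carrier λ x → R x × x ≉ 0# × ¬ IsUnitIn R x

  ContainsField : Pred → Set₁
  ContainsField R = Σ Pred λ F → F ⊆ R × IsSubring F ×
    (∀ {x} → F x → x ≉ 0# → Σ Carrier λ y → F y × x * y ≈ 1#)

  record IsTranscendentalDedekind (R : Pred) : Set₁ where
    field
      dedekind      : IsDedekindDomain R
      notField      : IsNotField R
      containsField : ContainsField R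

  AlgebraicOverFrac : Pred → Carrier → Set
  AlgebraicOverFrac R x = Σ (List Carrier) λ cs →
    All (Frac R) cs × Any (λ c → c ≉ 0#) cs × eval cs x ≈ 0#

  IsRootOfUnity : Carrier → Set
  IsRootOfUnity z = Σ ℕ λ k → pow z (suc k) ≈ 1#

  Principal : Pred → Carrier → Pred
  Principal R a x = Σ Carrier λ r → R r × x ≈ a * r

  CoprimeIdeals : Pred → Pred → Set
  CoprimeIdeals I J = Σ Carrier λ i → Σ Carrier λ j → I i × J j × i + j ≈ 1#

  _∣[_]_ : Carrier → Pred → Carrier → Set
  a ∣[ R ] b = Σ Carrier λ c → R c × b ≈ a * c

  Associated : Pred → Carrier → Carrier → Set
  Associated R a b = Σ Carrier λ u → IsUnitIn R u × a ≈ b * u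

  IsGCD : Pred → Carrier → Carrier → Carrier → Set
  IsGCD R a b g = R g × g ∣[ R ] a × g ∣[ R ] b ×
    (∀ {c} → R c → c ∣[ R ] a → c ∣[ R ] b → c ∣[ R ] g)

  IsLehmerSeq : Carrier → Carrier → (ℕ → Carrier) → Set
  IsLehmerSeq l e U = ∀ n →
    (¬ (2 ∣ n) → U n * (l - e) ≈ pow l n - pow e n) ×
    (2 ∣ n → U n * (pow l 2 - pow e 2) ≈ pow l n - pow e n)

module Submission where

open import Defs
open import Level using (0ℓ)
open import Algebra.Bundles using (CommutativeRing)
open import Data.Nat using (ℕ; NonZero)
open import Data.Nat.GCD using (gcd)
open import Data.Product using (Σ; _×_)
open import Relation.Nullary using (¬_)

open import Data.Nat using (zero; suc; s≤s; parity) renaming (_+_ to _+ℕ_; _≤_ to _≤ℕ_)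
import Data.Nat.Properties as ℕₚ
open import Data.Nat.Divisibility using (_∣_; _∣0; ∣-refl; ∣1⇒≡1; ∣m∣n⇒∣m+n; ∣m+n∣m⇒∣n)
open import Data.Nat.GCD using (GCD; gcd-GCD)
open import Data.Parity.Base as ℙ using (Parity; 0ℙ; 1ℙ; _⁻¹)
import Data.Parity.Properties as ℙₚ
open import Data.Fin using (Fin; #_)
open import Data.Vec using (Vec; []; _∷_; lookup)
open import Data.Product using (_,_; proj₁; proj₂)
open import Data.Sum using (inj₁; inj₂)
import Relation.Binary.PropositionalEquality as ≡
open ≡ using (_≡_)

-- Put P = l + e, a = P² and b = l e; a and b lie in R.  The Lehmer
-- sequence is realised as the sequence W in R with W₀ = 0, W₁ = 1 and
-- W (n+2) = cₙ W (n+1) − b W n, where cₙ = 1 for even and a for odd n.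
-- Multiplying W n by P at even indices gives the Lucas sequence
-- (lⁿ − eⁿ)/(l − e); its closed form identifies W with U, using l ≠ ±e
-- (as l/e is not a root of unity).  The Lucas addition formula gives
-- W (k+1+m) = C₁ W (k+1) W (m+1) − C₂ b W k W m with C₁, C₂ ∈ {1, a}, and
-- the coprimality of a and b shows that W m is coprime to C₁ W (m+1).
-- Hence (W m, W (k+1)) = (W m, W (k+1+m)) as ideals of R, and Euclid's
-- algorithm shows that W (gcd m n) generates (W m, W n); a generator of
-- this ideal is a gcd in R.

-- A decision procedure for identities in a commutative ring: an
-- expression is split into a positive and a negative part, each a
-- polynomial with natural coefficients, and  A - B ≈ C - D  is reduced
-- to the semiring identity  A + D ≈ C + B,  which the library solver
-- for commutative semirings decides.

module CommutativeRingSolver (L : CommutativeRing 0ℓ 0ℓ) where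
  open CommutativeRing L
  open import Relation.Binary.Reasoning.Setoid setoid
  open import Algebra.Properties.Ring ring using (-‿distribˡ-*; -‿distribʳ-*; -‿involutive; -‿+-comm; -0#≈0#)
  import Algebra.Solver.Ring.NaturalCoefficients.Default as NatCoeff
  module ℕSolver = NatCoeff commutativeSemiring
  open ℕSolver using (Polynomial; _:+_; _:*_; con; prove) renaming (var to pvar; ⟦_⟧ to ⟦_⟧⁺)

  infixl 6 _⊕_ _⊖_
  infixl 7 _⊗_
  infix 8 ⊝_

  data Expr (n : ℕ) : Set where
    var     : Fin n → Expr n
    _⊕_ _⊗_ : Expr n → Expr n → Expr n
    ⊝_      : Expr n → Expr n
    𝟙 𝟘     : Expr n

  _⊖_ : ∀ {n} → Expr n → Expr n → Expr n
  x ⊖ y = x ⊕ ⊝ y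

  x0 : ∀ {n} → Expr (1 +ℕ n)
  x0 = var (# 0)
  x1 : ∀ {n} → Expr (2 +ℕ n)
  x1 = var (# 1)
  x2 : ∀ {n} → Expr (3 +ℕ n)
  x2 = var (# 2)
  x3 : ∀ {n} → Expr (4 +ℕ n)
  x3 = var (# 3)
  x4 : ∀ {n} → Expr (5 +ℕ n)
  x4 = var (# 4)
  x5 : ∀ {n} → Expr (6 +ℕ n)
  x5 = var (# 5)
  x6 : ∀ {n} → Expr (7 +ℕ n)
  x6 = var (# 6)
  x7 : ∀ {n} → Expr (8 +ℕ n)
  x7 = var (# 7)
  x8 : ∀ {n} → Expr (9 +ℕ n)
  x8 = var (# 8)

  ⟦_⟧ : ∀ {n} → Expr n → Vec Carrier n → Carrier
  ⟦ var i ⟧ ρ = lookup ρ i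
  ⟦ x ⊕ y ⟧ ρ = ⟦ x ⟧ ρ + ⟦ y ⟧ ρ
  ⟦ x ⊗ y ⟧ ρ = ⟦ x ⟧ ρ * ⟦ y ⟧ ρ
  ⟦ ⊝ x ⟧ ρ   = - ⟦ x ⟧ ρ
  ⟦ 𝟙 ⟧ ρ     = 1#
  ⟦ 𝟘 ⟧ ρ     = 0#

  -- (positive part, negative part)
  split : ∀ {n} → Expr n → Polynomial n × Polynomial n
  split (var i) = pvar i , con 0
  split (x ⊕ y) with split x | split y
  ... | A , B | C , D = A :+ C , B :+ D
  split (x ⊗ y) with split x | split y
  ... | A , B | C , D = A :* C :+ B :* D , A :* D :+ B :* C
  split (⊝ x) with split x
  ... | A , B = B , A
  split 𝟙 = con 1 , con 0
  split 𝟘 = con 0 , con 0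

  private
    swap₂₃ : ∀ A B C D → (A + B) + (C + D) ≈ (A + C) + (B + D)
    swap₂₃ = ℕSolver.solve 4 (λ A B C D → (A :+ B) :+ (C :+ D) ℕSolver.:= (A :+ C) :+ (B :+ D)) refl

    minus-zero : ∀ x → x ≈ x - 0#
    minus-zero x = sym (trans (+-congˡ -0#≈0#) (+-identityʳ x))

    difference-+ : ∀ A B C D → (A - B) + (C - D) ≈ (A + C) - (B + D)
    difference-+ A B C D = trans (swap₂₃ A (- B) C (- D)) (+-congˡ (-‿+-comm B D))

    difference-* : ∀ A B C D → (A - B) * (C - D) ≈ (A * C + B * D) - (A * D + B * C)
    difference-* A B C D = begin
      (A - B) * (C - D)
        ≈⟨ ℕSolver.solve 4 (λ A B C D → (A :+ B) :* (C :+ D) ℕSolver.:= (A :* C :+ B :* D) :+ (A :* D :+ B :* C))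
                          refl A (- B) C (- D) ⟩
      (A * C + - B * - D) + (A * - D + - B * C)
        ≈⟨ +-cong (+-congˡ neg*neg) (+-cong (sym (-‿distribʳ-* A D)) (sym (-‿distribˡ-* B C))) ⟩
      (A * C + B * D) + (- (A * D) + - (B * C))
        ≈⟨ +-congˡ (-‿+-comm (A * D) (B * C)) ⟩
      (A * C + B * D) - (A * D + B * C) ∎
      where
      neg*neg : - B * - D ≈ B * D
      neg*neg = trans (sym (-‿distribˡ-* B (- D))) (trans (-‿cong (sym (-‿distribʳ-* B D))) (-‿involutive (B * D)))

    difference-neg : ∀ A B → - (A - B) ≈ B - A
    difference-neg A B = trans (sym (-‿+-comm A (- B))) (trans (+-comm (- A) (- - B)) (+-congʳ (-‿involutive B)))

    difference-≈ : ∀ A B C D → A + D ≈ C + B → A - B ≈ C - D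
    difference-≈ A B C D h = begin
      A - B                 ≈⟨ sym (+-identityʳ _) ⟩
      (A - B) + 0#          ≈⟨ +-congˡ (sym (-‿inverseʳ D)) ⟩
      (A + - B) + (D + - D) ≈⟨ swap₂₃ A (- B) D (- D) ⟩
      (A + D) + (- B + - D) ≈⟨ +-congʳ h ⟩
      (C + B) + (- B + - D) ≈⟨ ℕSolver.solve 4 (λ C B B' D' → (C :+ B) :+ (B' :+ D') ℕSolver.:= (C :+ D') :+ (B :+ B'))
                                               refl C B (- B) (- D) ⟩
      (C - D) + (B - B)     ≈⟨ +-congˡ (-‿inverseʳ B) ⟩
      (C - D) + 0#          ≈⟨ +-identityʳ _ ⟩
      C - D ∎

  split-correct : ∀ {n} (x : Expr n) ρ →
    ⟦ x ⟧ ρ ≈ ⟦ proj₁ (split x) ⟧⁺ ρ - ⟦ proj₂ (split x) ⟧⁺ ρ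
  split-correct (var i) ρ = minus-zero _
  split-correct (x ⊕ y) ρ with split x | split y | split-correct x ρ | split-correct y ρ
  ... | _ | _ | p | q = trans (+-cong p q) (difference-+ _ _ _ _)
  split-correct (x ⊗ y) ρ with split x | split y | split-correct x ρ | split-correct y ρ
  ... | _ | _ | p | q = trans (*-cong p q) (difference-* _ _ _ _)
  split-correct (⊝ x) ρ with split x | split-correct x ρ
  ... | _ | p = trans (-‿cong p) (difference-neg _ _)
  split-correct 𝟙 ρ = minus-zero _
  split-correct 𝟘 ρ = minus-zero _

  -- the solver: the side condition is closed by  refl  whenever the
  -- identity holds in every commutative ring
  ring-solve : ∀ {n} (x y : Expr n) ρ →
    ℕSolver.⟦ proj₁ (split x) :+ proj₂ (split y) ⟧↓ ρ ≈ ℕSolver.⟦ proj₁ (split y) :+ proj₂ (split x) ⟧↓ ρ →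
    ⟦ x ⟧ ρ ≈ ⟦ y ⟧ ρ
  ring-solve x y ρ h = trans (split-correct x ρ) (trans
    (difference-≈ _ _ _ _ (prove ρ (proj₁ (split x) :+ proj₂ (split y)) (proj₁ (split y) :+ proj₂ (split x)) h))
    (sym (split-correct y ρ)))

-- Euclid's algorithm as an induction principle: a property P d m n of
-- a candidate gcd d of (m, n) which holds for (m, m, 0), is symmetric
-- in (m, n) and survives  n ↦ n + m  holds for (gcd m n, m, n).

module EuclidInduction
  (P : ℕ → ℕ → ℕ → Set)
  (base : ∀ m → P m m 0)
  (swap : ∀ {d m n} → P d m n → P d n m)
  (step : ∀ {d m n} → P d m n → P d m (n +ℕ m))
  where

  Solved : ℕ → ℕ → Set
  Solved m n = Σ ℕ λ d → GCD m n d × P d m n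

  solved-swap : ∀ {m n} → Solved m n → Solved n m
  solved-swap (d , g , p) = d , GCD.sym g , swap p

  solved-step : ∀ {m n} → Solved m n → Solved m (n +ℕ m)
  solved-step {m} {n} (d , g , p) =
    d , ≡.subst (λ k → GCD m k d) (ℕₚ.+-comm m n) (GCD.step g) , step p

  -- subtractive Euclid, by recursion on a bound s ≥ m + n
  solve : ∀ s m n → m +ℕ n ≤ℕ s → Solved m n
  reduce : ∀ s {m n} → m ≤ℕ n → m +ℕ suc n ≤ℕ s → Solved (suc m) (suc n)

  solve _ m zero _ = m , GCD.sym GCD.base , base m
  solve _ zero (suc n) _ = solved-swap (suc n , GCD.sym GCD.base , base (suc n))
  solve (suc s) (suc m) (suc n) (s≤s h) with ℕₚ.≤-total m n
  ... | inj₁ m≤n = reduce s m≤n h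
  ... | inj₂ n≤m = solved-swap (reduce s n≤m
          (≡.subst (_≤ℕ s) (≡.trans (ℕₚ.+-comm m (suc n)) (≡.sym (ℕₚ.+-suc n m))) h))

  reduce s {m} {n} m≤n h with ℕₚ.m≤n⇒∃[o]m+o≡n m≤n
  ... | o , m+o≡n = ≡.subst (Solved (suc m)) o+[1+m]≡1+n (solved-step (solve s (suc m) o bound))
    where
    o+[1+m]≡1+n : o +ℕ suc m ≡ suc n
    o+[1+m]≡1+n = ≡.trans (ℕₚ.+-comm o (suc m)) (≡.cong suc m+o≡n)
    -- 1 + m + o = 1 + n ≤ m + (1 + n) ≤ s
    bound : suc m +ℕ o ≤ℕ s
    bound = ℕₚ.≤-trans (ℕₚ.≤-reflexive (≡.cong suc m+o≡n)) (ℕₚ.≤-trans (ℕₚ.m≤n+m (suc n) m) h)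

  gcd-induction : ∀ m n → P (gcd m n) m n
  gcd-induction m n with solve (m +ℕ n) m n ℕₚ.≤-refl
  ... | d , g , p = ≡.subst (λ k → P k m n) (GCD.unique g (gcd-GCD m n)) p

parity-suc : ∀ n → parity (suc n) ≡ parity n ⁻¹
parity-suc n = ≡.sym (ℙₚ.⁻¹-selfInverse (ℙₚ.suc-homo-⁻¹ n))

parity-addition : ∀ k m → parity (suc k +ℕ m) ≡ (parity k ℙ.+ parity m) ⁻¹
parity-addition k m = ≡.trans (parity-suc (k +ℕ m)) (≡.cong _⁻¹ (ℙₚ.+-homo-+ k m))

even⇒2∣ : ∀ n → parity n ≡ 0ℙ → 2 ∣ n
even⇒2∣ zero _ = 2 ∣0
even⇒2∣ (suc (suc n)) even = ∣m∣n⇒∣m+n ∣-refl (even⇒2∣ n even)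

odd⇒2∤ : ∀ n → parity n ≡ 1ℙ → ¬ (2 ∣ n)
odd⇒2∤ (suc zero) _ 2∣1 with ∣1⇒≡1 2∣1
... | ()
odd⇒2∤ (suc (suc n)) odd 2∣n+2 = odd⇒2∤ n odd (∣m+n∣m⇒∣n 2∣n+2 ∣-refl)

module SubringIdeals (L : CommutativeRing 0ℓ 0ℓ) (R : Pred L) (sub : IsSubring L R) where
  open CommutativeRing L
  open CommutativeRingSolver L
  open IsSubring sub using () renaming (0∈ to 0∈R; 1∈ to 1∈R; +-cl to +∈R; neg-cl to -∈R; *-cl to *∈R)
  open import Relation.Binary.Reasoning.Setoid setoid

  infix 4 _∣ᴿ_

  _∣ᴿ_ : Carrier → Carrier → Set
  x ∣ᴿ y = _∣[_]_ L x R y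

  InIdeal : Carrier → Carrier → Carrier → Set
  InIdeal p q x = Σ Carrier λ r → Σ Carrier λ s → R r × R s × x ≈ r * p + s * q

  Coprime : Carrier → Carrier → Set
  Coprime p q = InIdeal p q 1#

  -- g divides p and q and lies in the ideal (p, q); it then generates it
  Generates : Carrier → Carrier → Carrier → Set
  Generates g p q = g ∣ᴿ p × g ∣ᴿ q × InIdeal p q g

  ∣ᴿ-refl : ∀ {x} → x ∣ᴿ x
  ∣ᴿ-refl {x} = 1# , 1∈R , sym (*-identityʳ x)

  ∣ᴿ-zero : ∀ {x} → x ∣ᴿ 0#
  ∣ᴿ-zero {x} = 0# , 0∈R , sym (zeroʳ x)

  ∣ᴿ-resp : ∀ {g g' x x'} → g ≈ g' → x ≈ x' → g ∣ᴿ x → g' ∣ᴿ x'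
  ∣ᴿ-resp g≈g' x≈x' (c , c∈R , x≈gc) = c , c∈R , trans (sym x≈x') (trans x≈gc (*-congʳ g≈g'))

  ∣ᴿ-ideal : ∀ {g p q x} → g ∣ᴿ p → g ∣ᴿ q → InIdeal p q x → g ∣ᴿ x
  ∣ᴿ-ideal {g} {p} {q} {x} (c , c∈R , p≈gc) (d , d∈R , q≈gd) (r , s , r∈R , s∈R , x≈) =
    r * c + s * d , +∈R (*∈R r∈R c∈R) (*∈R s∈R d∈R) , (begin
      x                     ≈⟨ x≈ ⟩
      r * p + s * q         ≈⟨ +-cong (*-congˡ p≈gc) (*-congˡ q≈gd) ⟩
      r * (g * c) + s * (g * d)
        ≈⟨ ring-solve (x0 ⊗ (x1 ⊗ x2) ⊕ x3 ⊗ (x1 ⊗ x4)) (x1 ⊗ (x0 ⊗ x2 ⊕ x3 ⊗ x4)) (r ∷ g ∷ c ∷ s ∷ d ∷ []) refl ⟩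
      g * (r * c + s * d)   ∎)

  ideal-left : ∀ {p q} → InIdeal p q p
  ideal-left {p} {q} = 1# , 0# , 1∈R , 0∈R , ring-solve x0 (𝟙 ⊗ x0 ⊕ 𝟘 ⊗ x1) (p ∷ q ∷ []) refl

  ideal-zero : ∀ {p q} → InIdeal p q 0#
  ideal-zero {p} {q} = 0# , 0# , 0∈R , 0∈R , ring-solve 𝟘 (𝟘 ⊗ x0 ⊕ 𝟘 ⊗ x1) (p ∷ q ∷ []) refl

  ideal-swap : ∀ {p q x} → InIdeal p q x → InIdeal q p x
  ideal-swap (r , s , r∈R , s∈R , x≈) = s , r , s∈R , r∈R , trans x≈ (+-comm _ _)

  ideal-resp : ∀ {p q x p' q' x'} → p ≈ p' → q ≈ q' → x ≈ x' → InIdeal p q x → InIdeal p' q' x'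
  ideal-resp p≈ q≈ x≈ (r , s , r∈R , s∈R , h) =
    r , s , r∈R , s∈R , trans (sym x≈) (trans h (+-cong (*-congˡ p≈) (*-congˡ q≈)))

  ideal-trans : ∀ {p q x p' q'} → InIdeal p q x → InIdeal p' q' p → InIdeal p' q' q → InIdeal p' q' x
  ideal-trans {p} {q} {x} {p'} {q'} (r , s , r∈R , s∈R , x≈) (r₁ , s₁ , r₁∈R , s₁∈R , p≈) (r₂ , s₂ , r₂∈R , s₂∈R , q≈) =
    r * r₁ + s * r₂ , r * s₁ + s * s₂ , +∈R (*∈R r∈R r₁∈R) (*∈R s∈R r₂∈R) , +∈R (*∈R r∈R s₁∈R) (*∈R s∈R s₂∈R) ,
    (begin
      x                    ≈⟨ x≈ ⟩
      r * p + s * q        ≈⟨ +-cong (*-congˡ p≈) (*-congˡ q≈) ⟩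
      r * (r₁ * p' + s₁ * q') + s * (r₂ * p' + s₂ * q')
        ≈⟨ ring-solve (x0 ⊗ (x1 ⊗ x2 ⊕ x3 ⊗ x4) ⊕ x5 ⊗ (x6 ⊗ x2 ⊕ x7 ⊗ x4))
                      ((x0 ⊗ x1 ⊕ x5 ⊗ x6) ⊗ x2 ⊕ (x0 ⊗ x3 ⊕ x5 ⊗ x7) ⊗ x4)
                      (r ∷ r₁ ∷ p' ∷ s₁ ∷ q' ∷ s ∷ r₂ ∷ s₂ ∷ []) refl ⟩
      (r * r₁ + s * r₂) * p' + (r * s₁ + s * s₂) * q' ∎)

  coprime-one : ∀ {x} → Coprime x 1#
  coprime-one {x} = 0# , 1# , 0∈R , 1∈R , ring-solve 𝟙 (𝟘 ⊗ x0 ⊕ 𝟙 ⊗ 𝟙) (x ∷ []) refl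

  coprime-mul : ∀ {x y z} → R x → R y → R z → Coprime x y → Coprime x z → Coprime x (y * z)
  coprime-mul {x} {y} {z} x∈R y∈R z∈R (r₁ , s₁ , r₁∈R , s₁∈R , 1≈₁) (r₂ , s₂ , r₂∈R , s₂∈R , 1≈₂) =
    r₁ * r₂ * x + r₁ * s₂ * z + s₁ * y * r₂ , s₁ * s₂ ,
    +∈R (+∈R (*∈R (*∈R r₁∈R r₂∈R) x∈R) (*∈R (*∈R r₁∈R s₂∈R) z∈R)) (*∈R (*∈R s₁∈R y∈R) r₂∈R) , *∈R s₁∈R s₂∈R ,
    (begin
      1#                                      ≈⟨ sym (*-identityʳ 1#) ⟩
      1# * 1#                                 ≈⟨ *-cong 1≈₁ 1≈₂ ⟩
      (r₁ * x + s₁ * y) * (r₂ * x + s₂ * z)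
        ≈⟨ ring-solve ((x0 ⊗ x2 ⊕ x5 ⊗ x6) ⊗ (x1 ⊗ x2 ⊕ x3 ⊗ x4))
                      ((x0 ⊗ x1 ⊗ x2 ⊕ x0 ⊗ x3 ⊗ x4 ⊕ x5 ⊗ x6 ⊗ x1) ⊗ x2 ⊕ x5 ⊗ x3 ⊗ (x6 ⊗ x4))
                      (r₁ ∷ r₂ ∷ x ∷ s₂ ∷ z ∷ s₁ ∷ y ∷ []) refl ⟩
      (r₁ * r₂ * x + r₁ * s₂ * z + s₁ * y * r₂) * x + s₁ * s₂ * (y * z) ∎)

  coprime-neg : ∀ {x y} → Coprime x y → Coprime x (- y)
  coprime-neg {x} {y} (r , s , r∈R , s∈R , 1≈) = r , - s , r∈R , -∈R s∈R ,
    trans 1≈ (ring-solve (x0 ⊗ x1 ⊕ x2 ⊗ x3) (x0 ⊗ x1 ⊕ ⊝ x2 ⊗ ⊝ x3) (r ∷ x ∷ s ∷ y ∷ []) refl)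

  coprime-shift : ∀ {x y t} → R t → Coprime x y → Coprime x (y + t * x)
  coprime-shift {x} {y} {t} t∈R (r , s , r∈R , s∈R , 1≈) = r - s * t , s , +∈R r∈R (-∈R (*∈R s∈R t∈R)) , s∈R ,
    trans 1≈ (ring-solve (x0 ⊗ x1 ⊕ x2 ⊗ x3) ((x0 ⊖ x2 ⊗ x4) ⊗ x1 ⊕ x2 ⊗ (x3 ⊕ x4 ⊗ x1)) (r ∷ x ∷ s ∷ y ∷ t ∷ []) refl)

  coprime-ideals⇒coprime : ∀ {p q} → CoprimeIdeals L (Principal L R p) (Principal L R q) → Coprime p q
  coprime-ideals⇒coprime {p} {q} (i , j , (r , r∈R , i≈pr) , (s , s∈R , j≈qs) , i+j≈1) =
    r , s , r∈R , s∈R , sym (trans (+-cong (*-comm r p) (*-comm s q)) (trans (sym (+-cong i≈pr j≈qs)) i+j≈1))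

  associated-refl : ∀ {x} → Associated L R x x
  associated-refl {x} = 1# , (1∈R , 1# , 1∈R , *-identityʳ 1#) , sym (*-identityʳ x)

  generates-swap : ∀ {g p q} → Generates g p q → Generates g q p
  generates-swap (g∣p , g∣q , g∈) = g∣q , g∣p , ideal-swap g∈

  generates-step : ∀ {g p q q'} → InIdeal p q q' → InIdeal p q' q → Generates g p q → Generates g p q'
  generates-step q'∈ q∈ (g∣p , g∣q , g∈) = g∣p , ∣ᴿ-ideal g∣p g∣q q'∈ , ideal-trans g∈ ideal-left q∈

  generates-resp : ∀ {g p q g' p' q'} → g ≈ g' → p ≈ p' → q ≈ q' → Generates g p q → Generates g' p' q'
  generates-resp g≈ p≈ q≈ (g∣p , g∣q , g∈) = ∣ᴿ-resp g≈ p≈ g∣p , ∣ᴿ-resp g≈ q≈ g∣q , ideal-resp p≈ q≈ g≈ g∈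

  generates⇒gcd : ∀ {g p q} → R g → Generates g p q → IsGCD L R p q g
  generates⇒gcd g∈R (g∣p , g∣q , g∈) = g∈R , g∣p , g∣q , λ _ c∣p c∣q → ∣ᴿ-ideal c∣p c∣q g∈

  strong-divisibility : (V : ℕ → Carrier) → V 0 ≈ 0# →
    (∀ k m → InIdeal (V m) (V (suc k)) (V (suc k +ℕ m)) × InIdeal (V m) (V (suc k +ℕ m)) (V (suc k))) →
    ∀ m n → Generates (V (gcd m n)) (V m) (V n)
  strong-divisibility V V₀≈0 euclid = EuclidInduction.gcd-induction P base generates-swap step
    where
    P : ℕ → ℕ → ℕ → Set
    P d m n = Generates (V d) (V m) (V n)

    base : ∀ m → P m m 0
    base m = ∣ᴿ-refl , ∣ᴿ-resp refl (sym V₀≈0) ∣ᴿ-zero , ideal-left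

    step : ∀ {d m n} → P d m n → P d m (n +ℕ m)
    step {n = zero}  = generates-step ideal-left (ideal-resp refl refl (sym V₀≈0) ideal-zero)
    step {n = suc k} = generates-step (proj₁ (euclid k _)) (proj₂ (euclid k _))

module FieldFacts (L : CommutativeRing 0ℓ 0ℓ) (fld : IsField L) where
  open CommutativeRing L
  open IsField fld
  open CommutativeRingSolver L
  open import Relation.Binary.Reasoning.Setoid setoid
  open import Algebra.Properties.Ring ring using (-‿distribˡ-*)

  difference-zero : ∀ {x y} → x - y ≈ 0# → x ≈ y
  difference-zero {x} {y} x-y≈0 = begin
    x             ≈⟨ ring-solve x0 ((x0 ⊖ x1) ⊕ x1) (x ∷ y ∷ []) refl ⟩
    (x - y) + y   ≈⟨ +-congʳ x-y≈0 ⟩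
    0# + y        ≈⟨ +-identityˡ y ⟩
    y             ∎

  no-zero-divisors : ∀ {x y} → x ≉ 0# → x * y ≈ 0# → y ≈ 0#
  no-zero-divisors {x} {y} x≉0 xy≈0 = begin
    y                      ≈⟨ sym (*-identityʳ y) ⟩
    y * 1#                 ≈⟨ *-congˡ (sym (inv-r x x≉0)) ⟩
    y * (x * inv x x≉0)    ≈⟨ ring-solve (x0 ⊗ (x1 ⊗ x2)) ((x1 ⊗ x0) ⊗ x2) (y ∷ x ∷ inv x x≉0 ∷ []) refl ⟩
    (x * y) * inv x x≉0    ≈⟨ *-congʳ xy≈0 ⟩
    0# * inv x x≉0         ≈⟨ zeroˡ _ ⟩
    0#                     ∎

  *-nonzero : ∀ {x y} → x ≉ 0# → y ≉ 0# → x * y ≉ 0#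
  *-nonzero x≉0 y≉0 xy≈0 = y≉0 (no-zero-divisors x≉0 xy≈0)

  cancelʳ : ∀ {x y c} → c ≉ 0# → x * c ≈ y * c → x ≈ y
  cancelʳ {x} {y} {c} c≉0 xc≈yc = difference-zero (no-zero-divisors c≉0 (begin
    c * (x - y)     ≈⟨ ring-solve (x2 ⊗ (x0 ⊖ x1)) (x0 ⊗ x2 ⊖ x1 ⊗ x2) (x ∷ y ∷ c ∷ []) refl ⟩
    x * c - y * c   ≈⟨ +-congʳ xc≈yc ⟩
    y * c - y * c   ≈⟨ -‿inverseʳ (y * c) ⟩
    0#              ∎))

  module NotRootOfUnity {l e : Carrier} (e≉0 : e ≉ 0#) (not-root : ¬ IsRootOfUnity L (l * inv e e≉0)) where

    difference≉0 : l - e ≉ 0#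
    difference≉0 l-e≈0 = not-root (0 , (begin
      l * inv e e≉0 * 1#   ≈⟨ *-identityʳ _ ⟩
      l * inv e e≉0        ≈⟨ *-congʳ (difference-zero l-e≈0) ⟩
      e * inv e e≉0        ≈⟨ inv-r e e≉0 ⟩
      1#                   ∎))

    sum≉0 : l + e ≉ 0#
    sum≉0 l+e≈0 = not-root (1 , (begin
      z * (z * 1#)                ≈⟨ *-cong z≈-1 (*-congʳ z≈-1) ⟩
      - 1# * (- 1# * 1#)          ≈⟨ ring-solve (⊝ 𝟙 ⊗ (⊝ 𝟙 ⊗ 𝟙)) 𝟙 [] refl ⟩
      1#                          ∎))
      where
      z : Carrier
      z = l * inv e e≉0
      z≈-1 : z ≈ - 1#
      z≈-1 = begin
        l * inv e e≉0                  ≈⟨ *-congʳ (difference-zero (trans (ring-solve (x0 ⊖ ⊝ x1) (x0 ⊕ x1) (l ∷ e ∷ []) refl) l+e≈0)) ⟩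
        - e * inv e e≉0                ≈⟨ sym (-‿distribˡ-* e (inv e e≉0)) ⟩
        - (e * inv e e≉0)              ≈⟨ -‿cong (inv-r e e≉0) ⟩
        - 1#                           ∎

module LehmerSequence (L : CommutativeRing 0ℓ 0ℓ) (fld : IsField L) (R : Pred L) (sub : IsSubring L R) where
  open CommutativeRing L
  open CommutativeRingSolver L
  open FieldFacts L fld
  open SubringIdeals L R sub
  open IsSubring sub using () renaming (0∈ to 0∈R; 1∈ to 1∈R; +-cl to +∈R; neg-cl to -∈R; *-cl to *∈R)
  open import Relation.Binary.Reasoning.Setoid setoid

  pow-+ : ∀ x k m → pow L x (k +ℕ m) ≈ pow L x k * pow L x m
  pow-+ x zero    m = sym (*-identityˡ _)
  pow-+ x (suc k) m = trans (*-congˡ (pow-+ x k m)) (sym (*-assoc _ _ _))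

  module Lehmer (l e : Carrier) (l-e≉0 : l - e ≉ 0#) (l+e≉0 : l + e ≉ 0#)
    (a∈R : R (pow L (l + e) 2)) (b∈R : R (l * e)) (a⊥b : Coprime (pow L (l + e) 2) (l * e)) where

    P a b : Carrier
    P = l + e
    a = pow L P 2
    b = l * e

    lᵉ eᵉ Pᵉ aᵉ bᵉ : ∀ {n} → Expr (2 +ℕ n)
    lᵉ = x0
    eᵉ = x1
    Pᵉ = lᵉ ⊕ eᵉ
    aᵉ = Pᵉ ⊗ (Pᵉ ⊗ 𝟙)
    bᵉ = lᵉ ⊗ eᵉ

    coeff : Parity → Carrier
    coeff 0ℙ = 1#
    coeff 1ℙ = a

    coeff∈R : ∀ p → R (coeff p)
    coeff∈R 0ℙ = 1∈R
    coeff∈R 1ℙ = a∈R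

    W : ℕ → Carrier
    W zero = 0#
    W (suc zero) = 1#
    W (suc (suc n)) = coeff (parity n) * W (suc n) - b * W n

    W∈R : ∀ n → R (W n)
    W∈R zero = 0∈R
    W∈R (suc zero) = 1∈R
    W∈R (suc (suc n)) = +∈R (*∈R (coeff∈R (parity n)) (W∈R (suc n))) (-∈R (*∈R b∈R (W∈R n)))

    -- P at even and 1 at odd indices; W n · factor n is the Lucas
    -- sequence (lⁿ − eⁿ)/(l − e) of the pair (P, b)
    factor : Parity → Carrier
    factor 0ℙ = P
    factor 1ℙ = 1#

    lucas : ℕ → Carrier
    lucas n = W n * factor (parity n)

    factor-suc : ∀ n → factor (parity (suc n)) ≈ factor (parity n ⁻¹)
    factor-suc n = reflexive (≡.cong factor (parity-suc n))

    factor-recurrence : ∀ p w₀ w₁ →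
      (coeff p * w₁ - b * w₀) * factor p ≈ P * (w₁ * factor (p ⁻¹)) - b * (w₀ * factor p)
    factor-recurrence 0ℙ w₀ w₁ =
      ring-solve ((𝟙 ⊗ x3 ⊖ bᵉ ⊗ x2) ⊗ Pᵉ) (Pᵉ ⊗ (x3 ⊗ 𝟙) ⊖ bᵉ ⊗ (x2 ⊗ Pᵉ)) (l ∷ e ∷ w₀ ∷ w₁ ∷ []) refl
    factor-recurrence 1ℙ w₀ w₁ =
      ring-solve ((aᵉ ⊗ x3 ⊖ bᵉ ⊗ x2) ⊗ 𝟙) (Pᵉ ⊗ (x3 ⊗ Pᵉ) ⊖ bᵉ ⊗ (x2 ⊗ 𝟙)) (l ∷ e ∷ w₀ ∷ w₁ ∷ []) refl

    lucas-recurrence : ∀ n → lucas (suc (suc n)) ≈ P * lucas (suc n) - b * lucas n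
    lucas-recurrence n = trans (factor-recurrence (parity n) (W n) (W (suc n)))
      (+-congʳ (*-congˡ (*-congˡ (sym (factor-suc n)))))

    lucas-closed : ∀ n → lucas n * (l - e) ≈ pow L l n - pow L e n
    lucas-closed zero = ring-solve ((𝟘 ⊗ Pᵉ) ⊗ (lᵉ ⊖ eᵉ)) (𝟙 ⊖ 𝟙) (l ∷ e ∷ []) refl
    lucas-closed (suc zero) = ring-solve ((𝟙 ⊗ 𝟙) ⊗ (lᵉ ⊖ eᵉ)) (lᵉ ⊗ 𝟙 ⊖ eᵉ ⊗ 𝟙) (l ∷ e ∷ []) refl
    lucas-closed (suc (suc n)) = begin
      lucas (suc (suc n)) * (l - e)
        ≈⟨ *-congʳ (lucas-recurrence n) ⟩
      (P * lucas (suc n) - b * lucas n) * (l - e)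
        ≈⟨ ring-solve ((Pᵉ ⊗ x2 ⊖ bᵉ ⊗ x3) ⊗ (lᵉ ⊖ eᵉ)) (Pᵉ ⊗ (x2 ⊗ (lᵉ ⊖ eᵉ)) ⊖ bᵉ ⊗ (x3 ⊗ (lᵉ ⊖ eᵉ)))
                      (l ∷ e ∷ lucas (suc n) ∷ lucas n ∷ []) refl ⟩
      P * (lucas (suc n) * (l - e)) - b * (lucas n * (l - e))
        ≈⟨ +-cong (*-congˡ (lucas-closed (suc n))) (-‿cong (*-congˡ (lucas-closed n))) ⟩
      P * (pow L l (suc n) - pow L e (suc n)) - b * (pow L l n - pow L e n)
        ≈⟨ ring-solve (Pᵉ ⊗ (lᵉ ⊗ x2 ⊖ eᵉ ⊗ x3) ⊖ bᵉ ⊗ (x2 ⊖ x3)) (lᵉ ⊗ (lᵉ ⊗ x2) ⊖ eᵉ ⊗ (eᵉ ⊗ x3))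
                      (l ∷ e ∷ pow L l n ∷ pow L e n ∷ []) refl ⟩
      pow L l (suc (suc n)) - pow L e (suc (suc n)) ∎

    lucas-addition : ∀ k m → lucas (suc k +ℕ m) ≈ lucas (suc k) * lucas (suc m) - b * (lucas k * lucas m)
    lucas-addition k m = cancelʳ l-e≉0 (cancelʳ l-e≉0 (begin
      lucas (suc k +ℕ m) * D * D
        ≈⟨ *-congʳ (lucas-closed (suc k +ℕ m)) ⟩
      (l * pow L l (k +ℕ m) - e * pow L e (k +ℕ m)) * D
        ≈⟨ *-congʳ (+-cong (*-congˡ (pow-+ l k m)) (-‿cong (*-congˡ (pow-+ e k m)))) ⟩
      (l * (lᵏ * lᵐ) - e * (eᵏ * eᵐ)) * D
        ≈⟨ ring-solve ((lᵉ ⊗ (x2 ⊗ x3) ⊖ eᵉ ⊗ (x4 ⊗ x5)) ⊗ (lᵉ ⊖ eᵉ))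
                      ((lᵉ ⊗ x2 ⊖ eᵉ ⊗ x4) ⊗ (lᵉ ⊗ x3 ⊖ eᵉ ⊗ x5) ⊖ bᵉ ⊗ ((x2 ⊖ x4) ⊗ (x3 ⊖ x5)))
                      (l ∷ e ∷ lᵏ ∷ lᵐ ∷ eᵏ ∷ eᵐ ∷ []) refl ⟩
      (l * lᵏ - e * eᵏ) * (l * lᵐ - e * eᵐ) - b * ((lᵏ - eᵏ) * (lᵐ - eᵐ))
        ≈⟨ sym (+-cong (*-cong (lucas-closed (suc k)) (lucas-closed (suc m)))
                       (-‿cong (*-congˡ (*-cong (lucas-closed k) (lucas-closed m))))) ⟩
      (lucas (suc k) * D) * (lucas (suc m) * D) - b * ((lucas k * D) * (lucas m * D))
        ≈⟨ ring-solve ((x2 ⊗ (lᵉ ⊖ eᵉ)) ⊗ (x3 ⊗ (lᵉ ⊖ eᵉ)) ⊖ bᵉ ⊗ ((x4 ⊗ (lᵉ ⊖ eᵉ)) ⊗ (x5 ⊗ (lᵉ ⊖ eᵉ))))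
                      ((x2 ⊗ x3 ⊖ bᵉ ⊗ (x4 ⊗ x5)) ⊗ (lᵉ ⊖ eᵉ) ⊗ (lᵉ ⊖ eᵉ))
                      (l ∷ e ∷ lucas (suc k) ∷ lucas (suc m) ∷ lucas k ∷ lucas m ∷ []) refl ⟩
      (lucas (suc k) * lucas (suc m) - b * (lucas k * lucas m)) * D * D ∎))
      where
      D lᵏ lᵐ eᵏ eᵐ : Carrier
      D = l - e
      lᵏ = pow L l k
      lᵐ = pow L l m
      eᵏ = pow L e k
      eᵐ = pow L e m

    bothOdd : Parity → Parity → Carrier
    bothOdd 1ℙ 1ℙ = a
    bothOdd _  _  = 1#

    bothOdd∈R : ∀ p q → R (bothOdd p q)
    bothOdd∈R 0ℙ _  = 1∈R
    bothOdd∈R 1ℙ 0ℙ = 1∈R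
    bothOdd∈R 1ℙ 1ℙ = a∈R

    -- the factors at indices k and m, resp. k + 1 and m + 1, compared with
    -- the factor at k + 1 + m, where p, q are the parities of k, m
    factor-product : ∀ p q → factor p * factor q ≈ bothOdd (p ⁻¹) (q ⁻¹) * factor ((p ℙ.+ q) ⁻¹)
    factor-product 0ℙ 0ℙ = ring-solve (Pᵉ ⊗ Pᵉ) (aᵉ ⊗ 𝟙) (l ∷ e ∷ []) refl
    factor-product 0ℙ 1ℙ = ring-solve (Pᵉ ⊗ 𝟙) (𝟙 ⊗ Pᵉ) (l ∷ e ∷ []) refl
    factor-product 1ℙ 0ℙ = ring-solve (𝟙 ⊗ Pᵉ) (𝟙 ⊗ Pᵉ) (l ∷ e ∷ []) refl
    factor-product 1ℙ 1ℙ = ring-solve (𝟙 ⊗ 𝟙) (𝟙 ⊗ 𝟙) [] refl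

    factor-product-suc : ∀ p q → factor (p ⁻¹) * factor (q ⁻¹) ≈ bothOdd p q * factor ((p ℙ.+ q) ⁻¹)
    factor-product-suc 0ℙ 0ℙ = ring-solve (𝟙 ⊗ 𝟙) (𝟙 ⊗ 𝟙) [] refl
    factor-product-suc 0ℙ 1ℙ = ring-solve (𝟙 ⊗ Pᵉ) (𝟙 ⊗ Pᵉ) (l ∷ e ∷ []) refl
    factor-product-suc 1ℙ 0ℙ = ring-solve (Pᵉ ⊗ 𝟙) (𝟙 ⊗ Pᵉ) (l ∷ e ∷ []) refl
    factor-product-suc 1ℙ 1ℙ = ring-solve (Pᵉ ⊗ Pᵉ) (aᵉ ⊗ 𝟙) (l ∷ e ∷ []) refl

    factor≉0 : ∀ p → factor p ≉ 0#
    factor≉0 0ℙ = l+e≉0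
    factor≉0 1ℙ = IsField.1≉0 fld

    W-addition : ∀ k m →
      W (suc k +ℕ m) ≈ bothOdd (parity k) (parity m) * (W (suc k) * W (suc m))
                         - bothOdd (parity k ⁻¹) (parity m ⁻¹) * (b * (W k * W m))
    W-addition k m = cancelʳ (factor≉0 (parity (suc k +ℕ m))) (begin
      W (suc k +ℕ m) * F
        ≈⟨ lucas-addition k m ⟩
      (W (suc k) * fᵏ⁺¹) * (W (suc m) * fᵐ⁺¹) - b * ((W k * fᵏ) * (W m * fᵐ))
        ≈⟨ ring-solve ((x0 ⊗ x1) ⊗ (x2 ⊗ x3) ⊖ x4 ⊗ ((x5 ⊗ x6) ⊗ (x7 ⊗ x8)))
                      ((x0 ⊗ x2) ⊗ (x1 ⊗ x3) ⊖ x4 ⊗ ((x5 ⊗ x7) ⊗ (x6 ⊗ x8)))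
                      (W (suc k) ∷ fᵏ⁺¹ ∷ W (suc m) ∷ fᵐ⁺¹ ∷ b ∷ W k ∷ fᵏ ∷ W m ∷ fᵐ ∷ []) refl ⟩
      (W (suc k) * W (suc m)) * (fᵏ⁺¹ * fᵐ⁺¹) - b * ((W k * W m) * (fᵏ * fᵐ))
        ≈⟨ +-cong (*-congˡ (trans (*-cong (factor-suc k) (factor-suc m)) (factor-product-suc pᵏ pᵐ)))
                  (-‿cong (*-congˡ (*-congˡ (factor-product pᵏ pᵐ)))) ⟩
      (W (suc k) * W (suc m)) * (C₁ * F') - b * ((W k * W m) * (C₂ * F'))
        ≈⟨ ring-solve ((x0 ⊗ x1) ⊗ (x2 ⊗ x3) ⊖ x4 ⊗ ((x5 ⊗ x6) ⊗ (x7 ⊗ x3)))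
                      ((x2 ⊗ (x0 ⊗ x1) ⊖ x7 ⊗ (x4 ⊗ (x5 ⊗ x6))) ⊗ x3)
                      (W (suc k) ∷ W (suc m) ∷ C₁ ∷ F' ∷ b ∷ W k ∷ W m ∷ C₂ ∷ []) refl ⟩
      (C₁ * (W (suc k) * W (suc m)) - C₂ * (b * (W k * W m))) * F'
        ≈⟨ *-congˡ (reflexive (≡.cong factor (≡.sym (parity-addition k m)))) ⟩
      (C₁ * (W (suc k) * W (suc m)) - C₂ * (b * (W k * W m))) * F ∎)
      where
      pᵏ pᵐ : Parity
      pᵏ = parity k
      pᵐ = parity m
      F F' fᵏ fᵐ fᵏ⁺¹ fᵐ⁺¹ C₁ C₂ : Carrier
      F = factor (parity (suc k +ℕ m))
      F' = factor ((pᵏ ℙ.+ pᵐ) ⁻¹)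
      fᵏ = factor pᵏ
      fᵐ = factor pᵐ
      fᵏ⁺¹ = factor (parity (suc k))
      fᵐ⁺¹ = factor (parity (suc m))
      C₁ = bothOdd pᵏ pᵐ
      C₂ = bothOdd (pᵏ ⁻¹) (pᵐ ⁻¹)

    coprime-b-coeff : ∀ p → Coprime b (coeff p)
    coprime-b-coeff 0ℙ = coprime-one
    coprime-b-coeff 1ℙ = ideal-swap a⊥b

    coprime-b-W : ∀ n → Coprime b (W (suc n))
    coprime-b-W zero = coprime-one
    coprime-b-W (suc k) = ideal-resp refl
      (ring-solve (x2 ⊗ x3 ⊕ ⊝ x4 ⊗ bᵉ) (x2 ⊗ x3 ⊖ bᵉ ⊗ x4) (l ∷ e ∷ coeff (parity k) ∷ W (suc k) ∷ W k ∷ []) refl) refl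
      (coprime-shift (-∈R (W∈R k))
        (coprime-mul b∈R (coeff∈R (parity k)) (W∈R (suc k)) (coprime-b-coeff (parity k)) (coprime-b-W k)))

    coprime-W-adjacent : ∀ n → Coprime (W (suc n)) (W n)
    coprime-W-adjacent zero = ideal-swap coprime-one
    coprime-W-adjacent (suc k) = ideal-swap (ideal-resp refl
      (ring-solve (⊝ (bᵉ ⊗ x3) ⊕ x2 ⊗ x4) (x2 ⊗ x4 ⊖ bᵉ ⊗ x3) (l ∷ e ∷ coeff (parity k) ∷ W k ∷ W (suc k) ∷ []) refl) refl
      (coprime-shift (coeff∈R (parity k))
        (coprime-neg (coprime-mul (W∈R (suc k)) b∈R (W∈R k) (ideal-swap (coprime-b-W k)) (coprime-W-adjacent k)))))

    coprime-a-W-odd : ∀ n → parity n ≡ 1ℙ → Coprime a (W n)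
    coprime-a-W-odd (suc zero) _ = coprime-one
    coprime-a-W-odd (suc (suc k)) odd = ideal-resp refl
      (trans (ring-solve (⊝ (bᵉ ⊗ x2) ⊕ x3 ⊗ aᵉ) (aᵉ ⊗ x3 ⊖ bᵉ ⊗ x2) (l ∷ e ∷ W k ∷ W (suc k) ∷ []) refl)
             (+-congʳ (*-congʳ (reflexive (≡.cong coeff (≡.sym odd)))))) refl
      (coprime-shift (W∈R (suc k)) (coprime-neg (coprime-mul a∈R b∈R (W∈R k) a⊥b (coprime-a-W-odd k odd))))

    coprime-W-unit-lead : ∀ m → Coprime (W m) (1# * W (suc m))
    coprime-W-unit-lead m = ideal-resp refl (sym (*-identityˡ _)) refl (ideal-swap (coprime-W-adjacent m))

    -- W m is coprime to the leading term of the addition formula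
    coprime-W-lead : ∀ p m → Coprime (W m) (bothOdd p (parity m) * W (suc m))
    coprime-W-lead 0ℙ m = coprime-W-unit-lead m
    coprime-W-lead 1ℙ m with parity m in odd
    ... | 0ℙ = coprime-W-unit-lead m
    ... | 1ℙ = coprime-mul (W∈R m) a∈R (W∈R (suc m))
                 (ideal-swap (coprime-a-W-odd m odd)) (ideal-swap (coprime-W-adjacent m))

    W-euclid : ∀ k m → InIdeal (W m) (W (suc k)) (W (suc k +ℕ m)) × InIdeal (W m) (W (suc k +ℕ m)) (W (suc k))
    W-euclid k m = forward , backward
      where
      C₁ C₂ : Carrier
      C₁ = bothOdd (parity k) (parity m)
      C₂ = bothOdd (parity k ⁻¹) (parity m ⁻¹)
      C₁∈R : R C₁
      C₂∈R : R C₂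
      C₁∈R = bothOdd∈R (parity k) (parity m)
      C₂∈R = bothOdd∈R (parity k ⁻¹) (parity m ⁻¹)

      -- W (k+1+m) ≡ C₁ W (k+1) W (m+1)  modulo W m
      forward : InIdeal (W m) (W (suc k)) (W (suc k +ℕ m))
      forward = - (C₂ * (b * W k)) , C₁ * W (suc m) ,
        -∈R (*∈R C₂∈R (*∈R b∈R (W∈R k))) , *∈R C₁∈R (W∈R (suc m)) ,
        trans (W-addition k m)
          (ring-solve (x0 ⊗ (x1 ⊗ x2) ⊖ x3 ⊗ (x4 ⊗ (x5 ⊗ x6))) (⊝ (x3 ⊗ (x4 ⊗ x5)) ⊗ x6 ⊕ (x0 ⊗ x2) ⊗ x1)
                      (C₁ ∷ W (suc k) ∷ W (suc m) ∷ C₂ ∷ b ∷ W k ∷ W m ∷ []) refl)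

      -- since C₁ W (m+1) is invertible modulo W m, so is the converse
      backward : InIdeal (W m) (W (suc k +ℕ m)) (W (suc k))
      backward with coprime-W-lead (parity k) m
      ... | r , s , r∈R , s∈R , 1≈ =
        r * W (suc k) + s * (C₂ * (b * W k)) , s ,
        +∈R (*∈R r∈R (W∈R (suc k))) (*∈R s∈R (*∈R C₂∈R (*∈R b∈R (W∈R k)))) , s∈R ,
        (begin
          W (suc k)
            ≈⟨ sym (*-identityʳ _) ⟩
          W (suc k) * 1#
            ≈⟨ *-congˡ 1≈ ⟩
          W (suc k) * (r * W m + s * (C₁ * W (suc m)))
            ≈⟨ ring-solve (x0 ⊗ (x1 ⊗ x2 ⊕ x3 ⊗ (x4 ⊗ x5))) ((x1 ⊗ x0) ⊗ x2 ⊕ x3 ⊗ (x4 ⊗ (x0 ⊗ x5)))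
                          (W (suc k) ∷ r ∷ W m ∷ s ∷ C₁ ∷ W (suc m) ∷ []) refl ⟩
          (r * W (suc k)) * W m + s * (C₁ * (W (suc k) * W (suc m)))
            ≈⟨ +-congˡ (*-congˡ lead≈) ⟩
          (r * W (suc k)) * W m + s * (W (suc k +ℕ m) + C₂ * (b * (W k * W m)))
            ≈⟨ ring-solve ((x0 ⊗ x1) ⊗ x2 ⊕ x3 ⊗ (x4 ⊕ x5 ⊗ (x6 ⊗ (x7 ⊗ x2))))
                          ((x0 ⊗ x1 ⊕ x3 ⊗ (x5 ⊗ (x6 ⊗ x7))) ⊗ x2 ⊕ x3 ⊗ x4)
                          (r ∷ W (suc k) ∷ W m ∷ s ∷ W (suc k +ℕ m) ∷ C₂ ∷ b ∷ W k ∷ []) refl ⟩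
          (r * W (suc k) + s * (C₂ * (b * W k))) * W m + s * W (suc k +ℕ m) ∎)
        where
        lead≈ : C₁ * (W (suc k) * W (suc m)) ≈ W (suc k +ℕ m) + C₂ * (b * (W k * W m))
        lead≈ = trans (ring-solve x0 ((x0 ⊖ x1) ⊕ x1) (C₁ * (W (suc k) * W (suc m)) ∷ C₂ * (b * (W k * W m)) ∷ []) refl)
                      (+-congʳ (sym (W-addition k m)))

    W-Lehmer : (U : ℕ → Carrier) → IsLehmerSeq L l e U → ∀ n → U n ≈ W n
    W-Lehmer U lehmer n with parity n in par
    ... | 1ℙ = cancelʳ l-e≉0 (begin
      U n * (l - e)           ≈⟨ proj₁ (lehmer n) (odd⇒2∤ n par) ⟩
      pow L l n - pow L e n   ≈⟨ sym (lucas-closed n) ⟩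
      lucas n * (l - e)       ≈⟨ *-congʳ (trans (*-congˡ (reflexive (≡.cong factor par))) (*-identityʳ _)) ⟩
      W n * (l - e)           ∎)
    ... | 0ℙ = cancelʳ l²-e²≉0 (begin
      U n * (pow L l 2 - pow L e 2)   ≈⟨ proj₂ (lehmer n) (even⇒2∣ n par) ⟩
      pow L l n - pow L e n           ≈⟨ sym (lucas-closed n) ⟩
      lucas n * (l - e)               ≈⟨ *-congʳ (*-congˡ (reflexive (≡.cong factor par))) ⟩
      W n * P * (l - e)
        ≈⟨ ring-solve (x2 ⊗ Pᵉ ⊗ (lᵉ ⊖ eᵉ)) (x2 ⊗ (lᵉ ⊗ (lᵉ ⊗ 𝟙) ⊖ eᵉ ⊗ (eᵉ ⊗ 𝟙))) (l ∷ e ∷ W n ∷ []) refl ⟩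
      W n * (pow L l 2 - pow L e 2)   ∎)
      where
      l²-e²≉0 : pow L l 2 - pow L e 2 ≉ 0#
      l²-e²≉0 l²-e²≈0 = *-nonzero l+e≉0 l-e≉0
        (trans (ring-solve (Pᵉ ⊗ (lᵉ ⊖ eᵉ)) (lᵉ ⊗ (lᵉ ⊗ 𝟙) ⊖ eᵉ ⊗ (eᵉ ⊗ 𝟙)) (l ∷ e ∷ []) refl) l²-e²≈0)

theorem1p1 : (L : CommutativeRing 0ℓ 0ℓ) → (fld : IsField L) →
    let open CommutativeRing L in
    (R : Pred L) → IsTranscendentalDedekind L R →
    (l e : Carrier) → l ≉ 0# → (e≉0 : e ≉ 0#) →
    AlgebraicOverFrac L R l → AlgebraicOverFrac L R e →
    ¬ IsRootOfUnity L (l * IsField.inv fld e e≉0) →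
    R (pow L (l + e) 2) → R (l * e) →
    CoprimeIdeals L (Principal L R (pow L (l + e) 2)) (Principal L R (l * e)) →
    ¬ (_⊆_ L R (Principal L R (pow L (l + e) 2)) × _⊆_ L R (Principal L R (l * e))) →
    (U : ℕ → Carrier) → IsLehmerSeq L l e U →
    ((n : ℕ) → .{{NonZero n}} → R (U n)) ×
    ((m n : ℕ) → .{{NonZero m}} → .{{NonZero n}} →
    Σ Carrier λ g → IsGCD L R (U m) (U n) g × Associated L R g (U (gcd m n)))
theorem1p1 L fld R transcendental l e _ e≉0 _ _ not-root a∈R b∈R ⟨a⟩+⟨b⟩≡R _ U lehmer =
  (λ n → U∈R n) ,
  (λ m n → U (gcd m n) , generates⇒gcd (U∈R (gcd m n)) (U-generates m n) , associated-refl)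
  where
  open CommutativeRing L
  sub : IsSubring L R
  sub = IsDedekindDomain.subring (IsTranscendentalDedekind.dedekind transcendental)
  open SubringIdeals L R sub
  open FieldFacts L fld
  open NotRootOfUnity e≉0 not-root
  open LehmerSequence.Lehmer L fld R sub l e difference≉0 sum≉0 a∈R b∈R (coprime-ideals⇒coprime ⟨a⟩+⟨b⟩≡R)

  W≈U : ∀ n → W n ≈ U n
  W≈U n = sym (W-Lehmer U lehmer n)

  U∈R : ∀ n → R (U n)
  U∈R n = IsSubring.resp sub (W≈U n) (W∈R n)

  U-generates : ∀ m n → Generates (U (gcd m n)) (U m) (U n)
  U-generates m n = generates-resp (W≈U _) (W≈U m) (W≈U n) (strong-divisibility W refl W-euclid m n)
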